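{- None of the schemas $\circ\circ\alpha$, $\circ\alpha\rightarrow\circ\circ\alpha$, $(\alpha\wedge\circ\alpha)\rightarrow\circ\circ\alpha$, $(\neg\alpha\wedge\circ\alpha)\rightarrow\circ\circ\alpha$ is derivable in $\mathbf{RCbr}$; that is, for each of these four schemas there is a formula $\alpha$ such that the corresponding instance is not a theorem of $\mathbf{RCbr}$.
   Context: Formulas are built from a denumerable set of propositional variables using binary $\wedge,\vee,\rightarrow$ and unary $\neg,\circ$; $\alpha\leftrightarrow\beta$ abbreviates $(\alpha\rightarrow\beta)\wedge(\beta\rightarrow\alpha)$. The logic $\mathbf{Cbr}$ is the Hilbert calculus with modus ponens as only rule and axiom schemas: (1) $\alpha\rightarrow(\beta\rightarrow\alpha)$; (2) $(\alpha\rightarrow(\beta\rightarrow\gamma))\rightarrow((\alpha\rightarrow\beta)\rightarrow(\alpha\rightarrow\gamma))$; (3) $\alpha\rightarrow(\beta\rightarrow(\alpha\wedge\beta))$; (4) $(\alpha\wedge\beta)\rightarrow\alpha$; (5) $(\alpha\wedge\beta)\rightarrow\beta$; (6) $\alpha\rightarrow(\alpha\vee\beta)$; (7) $\beta\rightarrow(\alpha\vee\beta)$; (8) $(\alpha\rightarrow\gamma)\rightarrow((\beta\rightarrow\gamma)\rightarrow((\alpha\vee\beta)\rightarrow\gamma))$; (9) $(\alpha\rightarrow\beta)\vee\alpha$; (10) $\alpha\vee\neg\alpha$; (11) $\circ\alpha\rightarrow(\alpha\rightarrow(\neg\alpha\rightarrow\beta))$; (12) $\circ\alpha\vee(\alpha\wedge\neg\alpha)$;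 (13) $\alpha\rightarrow\neg\neg\alpha$; (14) $\neg\neg\alpha\rightarrow\alpha$. The logic $\mathbf{RCbr}$ is obtained from $\mathbf{Cbr}$ by adding the rules "from $\alpha\leftrightarrow\beta$ infer $\neg\alpha\leftrightarrow\neg\beta$" and "from $\alpha\leftrightarrow\beta$ infer $\circ\alpha\leftrightarrow\circ\beta$"; $\vdash_{\mathbf{RCbr}}\alpha$ means $\alpha$ has a derivation without premises in this calculus. -}

module Defs where

open import Data.Nat using (ℕ)

infixr 5 _⇒_
infixr 6 _∨′_
infixr 7 _∧′_
data Formula : Set where
  var  : ℕ → Formula
  _∧′_ : Formula → Formula → Formula
  _∨′_ : Formula → Formula → Formula
  _⇒_  : Formula → Formula → Formula
  ¬′_  : Formula → Formula
  ∘′_  : Formula → Formula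

infix 4 _⇔_
_⇔_ : Formula → Formula → Formula
α ⇔ β = (α ⇒ β) ∧′ (β ⇒ α)

data ⊢RCbr : Formula → Set where
  ax1  : ∀ α β → ⊢RCbr (α ⇒ (β ⇒ α))
  ax2  : ∀ α β γ → ⊢RCbr ((α ⇒ (β ⇒ γ)) ⇒ ((α ⇒ β) ⇒ (α ⇒ γ)))
  ax3  : ∀ α β → ⊢RCbr (α ⇒ (β ⇒ (α ∧′ β)))
  ax4  : ∀ α β → ⊢RCbr ((α ∧′ β) ⇒ α)
  ax5  : ∀ α β → ⊢RCbr ((α ∧′ β) ⇒ β)
  ax6  : ∀ α β → ⊢RCbr (α ⇒ (α ∨′ β))
  ax7  : ∀ α β → ⊢RCbr (β ⇒ (α ∨′ β))
  ax8  : ∀ α β γ → ⊢RCbr ((α ⇒ γ) ⇒ ((β ⇒ γ) ⇒ ((α ∨′ β) ⇒ γ)))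
  ax9  : ∀ α β → ⊢RCbr ((α ⇒ β) ∨′ α)
  ax10 : ∀ α → ⊢RCbr (α ∨′ ¬′ α)
  ax11 : ∀ α β → ⊢RCbr (∘′ α ⇒ (α ⇒ (¬′ α ⇒ β)))
  ax12 : ∀ α → ⊢RCbr (∘′ α ∨′ (α ∧′ ¬′ α))
  ax13 : ∀ α → ⊢RCbr (α ⇒ ¬′ ¬′ α)
  ax14 : ∀ α → ⊢RCbr (¬′ ¬′ α ⇒ α)
  mp   : ∀ {α β} → ⊢RCbr α → ⊢RCbr (α ⇒ β) → ⊢RCbr β
  rep¬ : ∀ {α β} → ⊢RCbr (α ⇔ β) → ⊢RCbr (¬′ α ⇔ ¬′ β)
  rep∘ : ∀ {α β} → ⊢RCbr (α ⇔ β) → ⊢RCbr (∘′ α ⇔ ∘′ β)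

{-# OPTIONS --safe #-}
-- RCbr is sound for any algebra of sets with an involutive negation ¬ such that x ∪ ¬x is
-- everything, reading ∘x as the complement of x ∩ ¬x: at each point the axioms are Boolean
-- tautologies, and the replacement rules hold because ¬ acts on the value of a formula.
-- On a finite algebra such a ¬ is forced to be the complement, which makes ∘ constantly true,
-- so we use triples of finite or cofinite subsets of ℕ and let ¬ be the complement except on
-- two increasing ℤ-indexed chains X and Z and their complements, where ¬ (X z) = ∁ (X (z - 1))
-- and ¬ (∁ (X z)) = X (z + 1), and likewise for Z. Since X 0 ∩ ¬ (X 0) = Z 0, we get
-- ∘ (X 0) = ∁ (Z 0), whose negation is Z 1, so ∘∘ (X 0) = ∁ (Z 1 ∖ Z 0) is not everything,
-- and a variable interpreted as X 0 refutes all four schemas.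
module Submission where

open import Defs
open import Data.Bool using (Bool; true; false; not; _∧_; _∨_; _xor_; T)
open import Data.Bool.Properties
  using (T-∧; not-involutive; ∨-comm; xor-identityʳ; xor-same)
  renaming (_≟_ to _≟ᵇ_)
open import Data.Integer using (ℤ; +_; -[1+_]; _⊖_; -_; pred) renaming (suc to sucℤ)
open import Data.Integer.Properties using (suc-pred; pred-suc)
open import Data.List using (List; []; _∷_; _∷ʳ_; replicate; length; foldr)
open import Data.List.Properties using (length-replicate) renaming (≡-dec to ≡-decᴸ)
open import Data.Nat using (ℕ; zero; suc; _+_; _≤_; s≤s)
open import Data.Nat.Properties using (m≤m+n; m≤n+m)
open import Data.Product using (∃; _×_; _,_; proj₁; proj₂; uncurry)
open import Data.Product.Properties using () renaming (≡-dec to ≡-dec×)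
open import Data.Sum using (_⊎_; inj₁; inj₂)
open import Data.Unit using (tt)
open import Function using (_∘_)
open import Function.Bundles using (Equivalence)
open import Relation.Binary.Definitions using (DecidableEquality)
open import Relation.Binary.PropositionalEquality
open import Relation.Nullary using (¬_; yes; no; contradiction)
import Relation.Nullary.Decidable as Dec

infixr 4 _⇒ᵇ_
_⇒ᵇ_ : Bool → Bool → Bool
a ⇒ᵇ b = not a ∨ b

∀ᵇ : (Bool → Bool) → Bool
∀ᵇ f = f false ∧ f true

∀ᵇ-elim : ∀ f → T (∀ᵇ f) → ∀ b → T (f b)
∀ᵇ-elim f t false = proj₁ (Equivalence.to T-∧ t)
∀ᵇ-elim f t true  = proj₂ (Equivalence.to T-∧ t)

-- The implicit truth table reduces to ⊤ for a concrete tautology f, so Agda fills it in.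
tautology : (f : Bool → Bool → Bool → Bool) →
            {T (∀ᵇ λ a → ∀ᵇ λ b → ∀ᵇ (f a b))} → ∀ a b c → T (f a b c)
tautology f {t} a b c =
  ∀ᵇ-elim (f a b) (∀ᵇ-elim (λ b → ∀ᵇ (f a b)) (∀ᵇ-elim (λ a → ∀ᵇ λ b → ∀ᵇ (f a b)) t a) b) c

⇒ᵇ-true : ∀ a → T (a ⇒ᵇ true)
⇒ᵇ-true a = tautology (λ a _ _ → a ⇒ᵇ true) a false false

⇒ᵇ-contrapose : ∀ {a b} → T (a ⇒ᵇ b) → T (not b ⇒ᵇ not a)
⇒ᵇ-contrapose {false} {_}    _ = ⇒ᵇ-true _
⇒ᵇ-contrapose {true}  {true} _ = tt

⇒ᵇ-modus-ponens : ∀ {a b} → T a → T (a ⇒ᵇ b) → T b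
⇒ᵇ-modus-ponens {true} _ t = t

⇔ᵇ⇒≡ : ∀ a b → T ((a ⇒ᵇ b) ∧ (b ⇒ᵇ a)) → a ≡ b
⇔ᵇ⇒≡ false false _ = refl
⇔ᵇ⇒≡ true  true  _ = refl

≡⇒⇔ᵇ : ∀ {a b} → a ≡ b → T ((a ⇒ᵇ b) ∧ (b ⇒ᵇ a))
≡⇒⇔ᵇ {a} refl = tautology (λ a _ _ → (a ⇒ᵇ a) ∧ (a ⇒ᵇ a)) a false false

xor-cancelˡ : ∀ a b → a xor (a xor b) ≡ b
xor-cancelˡ false b = refl
xor-cancelˡ true  b = not-involutive b

-- Subsets of P with unique representatives (χ-injective), so that every function on Carrier,
-- in particular a negation, respects extensional equality of sets.
record SetAlgebra (P : Set) : Set₁ where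
  field
    Carrier     : Set
    χ           : Carrier → P → Bool
    χ-injective : ∀ {x y} → χ x ≗ χ y → x ≡ y
    zipWith     : (Bool → Bool → Bool) → Carrier → Carrier → Carrier
    χ-zipWith   : ∀ f x y p → χ (zipWith f x y) p ≡ f (χ x p) (χ y p)

  ∁ : Carrier → Carrier
  ∁ x = zipWith (λ a _ → not a) x x

  χ-∁ : ∀ x p → χ (∁ x) p ≡ not (χ x p)
  χ-∁ x = χ-zipWith _ x x

  ∁-involutive : ∀ x → ∁ (∁ x) ≡ x
  ∁-involutive x = χ-injective λ p →
    trans (χ-∁ (∁ x) p) (trans (cong not (χ-∁ x p)) (not-involutive (χ x p)))

  infix 4 _⊆_
  _⊆_ : Carrier → Carrier → Set
  x ⊆ y = ∀ p → T (χ x p ⇒ᵇ χ y p)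

  ⊆⇒∁-covers : ∀ {x y} → x ⊆ y → ∀ p → T (χ (∁ x) p ∨ χ y p)
  ⊆⇒∁-covers {x} {y} x⊆y p = subst (λ a → T (a ∨ χ y p)) (sym (χ-∁ x p)) (x⊆y p)

infixr 2 _×ˢ_
_×ˢ_ : ∀ {P Q} → SetAlgebra P → SetAlgebra Q → SetAlgebra (P ⊎ Q)
𝒜 ×ˢ ℬ = record
  { Carrier     = A.Carrier × B.Carrier
  ; χ           = λ { (x , _) (inj₁ p) → A.χ x p ; (_ , y) (inj₂ q) → B.χ y q }
  ; χ-injective = λ eq → cong₂ _,_ (A.χ-injective (eq ∘ inj₁)) (B.χ-injective (eq ∘ inj₂))
  ; zipWith     = λ { f (x , y) (x′ , y′) → A.zipWith f x x′ , B.zipWith f y y′ }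
  ; χ-zipWith   = λ { f (x , _) (x′ , _) (inj₁ p) → A.χ-zipWith f x x′ p
                    ; f (_ , y) (_ , y′) (inj₂ q) → B.χ-zipWith f y y′ q }
  }
  where
    module A = SetAlgebra 𝒜
    module B = SetAlgebra ℬ

record Negation {P : Set} (𝒜 : SetAlgebra P) : Set where
  open SetAlgebra 𝒜
  field
    ¬ᴬ            : Carrier → Carrier
    ¬ᴬ-involutive : ∀ x → ¬ᴬ (¬ᴬ x) ≡ x
    ¬ᴬ-covers     : ∀ x p → T (χ x p ∨ χ (¬ᴬ x) p)

module Soundness {P : Set} {𝒜 : SetAlgebra P} (𝒩 : Negation 𝒜) where
  open SetAlgebra 𝒜
  open Negation 𝒩

  ⟦_⟧ : Formula → (ℕ → Carrier) → Carrier
  ⟦ var n  ⟧ v = v n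
  ⟦ φ ∧′ ψ ⟧ v = zipWith _∧_ (⟦ φ ⟧ v) (⟦ ψ ⟧ v)
  ⟦ φ ∨′ ψ ⟧ v = zipWith _∨_ (⟦ φ ⟧ v) (⟦ ψ ⟧ v)
  ⟦ φ ⇒ ψ  ⟧ v = zipWith _⇒ᵇ_ (⟦ φ ⟧ v) (⟦ ψ ⟧ v)
  ⟦ ¬′ φ   ⟧ v = ¬ᴬ (⟦ φ ⟧ v)
  ⟦ ∘′ φ   ⟧ v = zipWith (λ a b → not (a ∧ b)) (⟦ φ ⟧ v) (¬ᴬ (⟦ φ ⟧ v))

  -- Computed connective by connective, rather than as χ (⟦ φ ⟧ v) p, so that axiom
  -- instances reduce definitionally to Boolean tautologies.
  truth : (ℕ → Carrier) → P → Formula → Bool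
  truth v p (var n)  = χ (v n) p
  truth v p (φ ∧′ ψ) = truth v p φ ∧ truth v p ψ
  truth v p (φ ∨′ ψ) = truth v p φ ∨ truth v p ψ
  truth v p (φ ⇒ ψ)  = truth v p φ ⇒ᵇ truth v p ψ
  truth v p (¬′ φ)   = χ (¬ᴬ (⟦ φ ⟧ v)) p
  truth v p (∘′ φ)   = not (truth v p φ ∧ truth v p (¬′ φ))

  χ-⟦⟧ : ∀ φ v p → χ (⟦ φ ⟧ v) p ≡ truth v p φ
  χ-⟦⟧ (var n)  v p = refl
  χ-⟦⟧ (φ ∧′ ψ) v p = trans (χ-zipWith _ _ _ p) (cong₂ _∧_ (χ-⟦⟧ φ v p) (χ-⟦⟧ ψ v p))
  χ-⟦⟧ (φ ∨′ ψ) v p = trans (χ-zipWith _ _ _ p) (cong₂ _∨_ (χ-⟦⟧ φ v p) (χ-⟦⟧ ψ v p))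
  χ-⟦⟧ (φ ⇒ ψ)  v p = trans (χ-zipWith _ _ _ p) (cong₂ _⇒ᵇ_ (χ-⟦⟧ φ v p) (χ-⟦⟧ ψ v p))
  χ-⟦⟧ (¬′ φ)   v p = refl
  χ-⟦⟧ (∘′ φ)   v p =
    trans (χ-zipWith _ _ _ p) (cong (λ a → not (a ∧ truth v p (¬′ φ))) (χ-⟦⟧ φ v p))

  ⟦⟧-cong : ∀ {φ ψ} v → (∀ p → T (truth v p (φ ⇔ ψ))) → ⟦ φ ⟧ v ≡ ⟦ ψ ⟧ v
  ⟦⟧-cong {φ} {ψ} v φ⇔ψ = χ-injective λ p →
    trans (χ-⟦⟧ φ v p) (trans (⇔ᵇ⇒≡ _ _ (φ⇔ψ p)) (sym (χ-⟦⟧ ψ v p)))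

  truth-¬¬ : ∀ φ v p → truth v p (¬′ ¬′ φ) ≡ truth v p φ
  truth-¬¬ φ v p = trans (cong (λ x → χ x p) (¬ᴬ-involutive (⟦ φ ⟧ v))) (χ-⟦⟧ φ v p)

  sound : ∀ {φ} → ⊢RCbr φ → ∀ v p → T (truth v p φ)
  sound (ax1 α β) v p =
    tautology (λ a b _ → a ⇒ᵇ b ⇒ᵇ a) (truth v p α) (truth v p β) false
  sound (ax2 α β γ) v p =
    tautology (λ a b c → (a ⇒ᵇ b ⇒ᵇ c) ⇒ᵇ (a ⇒ᵇ b) ⇒ᵇ a ⇒ᵇ c)
              (truth v p α) (truth v p β) (truth v p γ)
  sound (ax3 α β) v p =
    tautology (λ a b _ → a ⇒ᵇ b ⇒ᵇ a ∧ b) (truth v p α) (truth v p β) false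
  sound (ax4 α β) v p =
    tautology (λ a b _ → a ∧ b ⇒ᵇ a) (truth v p α) (truth v p β) false
  sound (ax5 α β) v p =
    tautology (λ a b _ → a ∧ b ⇒ᵇ b) (truth v p α) (truth v p β) false
  sound (ax6 α β) v p =
    tautology (λ a b _ → a ⇒ᵇ a ∨ b) (truth v p α) (truth v p β) false
  sound (ax7 α β) v p =
    tautology (λ a b _ → b ⇒ᵇ a ∨ b) (truth v p α) (truth v p β) false
  sound (ax8 α β γ) v p =
    tautology (λ a b c → (a ⇒ᵇ c) ⇒ᵇ (b ⇒ᵇ c) ⇒ᵇ a ∨ b ⇒ᵇ c)
              (truth v p α) (truth v p β) (truth v p γ)
  sound (ax9 α β) v p =
    tautology (λ a b _ → (a ⇒ᵇ b) ∨ a) (truth v p α) (truth v p β) false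
  sound (ax10 α) v p =
    subst (λ a → T (a ∨ truth v p (¬′ α))) (χ-⟦⟧ α v p) (¬ᴬ-covers (⟦ α ⟧ v) p)
  sound (ax11 α β) v p =
    tautology (λ a n b → not (a ∧ n) ⇒ᵇ a ⇒ᵇ n ⇒ᵇ b)
              (truth v p α) (truth v p (¬′ α)) (truth v p β)
  sound (ax12 α) v p =
    tautology (λ a n _ → not (a ∧ n) ∨ (a ∧ n)) (truth v p α) (truth v p (¬′ α)) false
  sound (ax13 α) v p =
    subst (λ b → T (truth v p α ⇒ᵇ b)) (sym (truth-¬¬ α v p))
          (tautology (λ a _ _ → a ⇒ᵇ a) (truth v p α) false false)
  sound (ax14 α) v p =
    subst (λ a → T (a ⇒ᵇ truth v p α)) (sym (truth-¬¬ α v p))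
          (tautology (λ a _ _ → a ⇒ᵇ a) (truth v p α) false false)
  sound (mp d e) v p = ⇒ᵇ-modus-ponens (sound d v p) (sound e v p)
  sound (rep¬ {α} {β} d) v p =
    ≡⇒⇔ᵇ (cong (λ x → χ (¬ᴬ x) p) (⟦⟧-cong {α} {β} v (sound d v)))
  sound (rep∘ {α} {β} d) v p =
    ≡⇒⇔ᵇ (cong₂ (λ a n → not (a ∧ n)) (⇔ᵇ⇒≡ (truth v p α) (truth v p β) (sound d v p))
                                      (cong (λ x → χ (¬ᴬ x) p) (⟦⟧-cong {α} {β} v (sound d v))))

  unprovable : ∀ {φ} v p → truth v p φ ≡ false → ¬ ⊢RCbr φ
  unprovable v p φ-false d = subst T φ-false (sound d v p)

-- candidate x is the only s for which element s can be x, so a single equality test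
-- decides whether x is special.
record PartnerStructure {P : Set} (𝒜 : SetAlgebra P) : Set₁ where
  open SetAlgebra 𝒜
  field
    _≟_                : DecidableEquality Carrier
    Special            : Set
    element            : Special → Carrier
    candidate          : Carrier → Special
    candidate-element  : ∀ s → candidate (element s) ≡ s
    partner            : Special → Special
    partner-involutive : ∀ s → partner (partner s) ≡ s
    partner-covers     : ∀ s p → T (χ (element s) p ∨ χ (element (partner s)) p)
    ∁-element          : ∀ s → ∃ λ t → element t ≡ ∁ (element s)

module PartnerNegation {P : Set} {𝒜 : SetAlgebra P} (𝒮 : PartnerStructure 𝒜) where
  open SetAlgebra 𝒜
  open PartnerStructure 𝒮

  ¬ᴾ : Carrier → Carrier
  ¬ᴾ x with element (candidate x) ≟ x
  ... | yes _ = element (partner (candidate x))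
  ... | no  _ = ∁ x

  Ordinary : Carrier → Set
  Ordinary x = ∀ s → element s ≢ x

  data View : Carrier → Set where
    special  : ∀ s → View (element s)
    ordinary : ∀ {x} → Ordinary x → View x

  view : ∀ x → View x
  view x with element (candidate x) ≟ x
  ... | yes is-special = subst View is-special (special (candidate x))
  ... | no  ≢x         = ordinary λ s s↦x →
    ≢x (trans (cong (element ∘ candidate) (sym s↦x)) (trans (cong element (candidate-element s)) s↦x))

  ¬ᴾ-special : ∀ s → ¬ᴾ (element s) ≡ element (partner s)
  ¬ᴾ-special s with element (candidate (element s)) ≟ element s
  ... | yes _ = cong (element ∘ partner) (candidate-element s)
  ... | no ≢s = contradiction (cong element (candidate-element s)) ≢s

  ¬ᴾ-ordinary : ∀ {x} → Ordinary x → ¬ᴾ x ≡ ∁ x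
  ¬ᴾ-ordinary {x} o with element (candidate x) ≟ x
  ... | yes is-special = contradiction is-special (o (candidate x))
  ... | no  _          = refl

  ∁-ordinary : ∀ {x} → Ordinary x → Ordinary (∁ x)
  ∁-ordinary {x} o s s↦∁x with ∁-element s
  ... | t , t↦∁s = o t (trans t↦∁s (trans (cong ∁ s↦∁x) (∁-involutive x)))

  ¬ᴾ-involutive : ∀ x → ¬ᴾ (¬ᴾ x) ≡ x
  ¬ᴾ-involutive x with view x
  ... | special s = begin
    ¬ᴾ (¬ᴾ (element s))           ≡⟨ cong ¬ᴾ (¬ᴾ-special s) ⟩
    ¬ᴾ (element (partner s))      ≡⟨ ¬ᴾ-special (partner s) ⟩
    element (partner (partner s)) ≡⟨ cong element (partner-involutive s) ⟩
    element s                     ∎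
    where open ≡-Reasoning
  ... | ordinary o = begin
    ¬ᴾ (¬ᴾ x) ≡⟨ cong ¬ᴾ (¬ᴾ-ordinary o) ⟩
    ¬ᴾ (∁ x)  ≡⟨ ¬ᴾ-ordinary (∁-ordinary o) ⟩
    ∁ (∁ x)   ≡⟨ ∁-involutive x ⟩
    x         ∎
    where open ≡-Reasoning

  ¬ᴾ-covers : ∀ x p → T (χ x p ∨ χ (¬ᴾ x) p)
  ¬ᴾ-covers x p with view x
  ... | special s =
    subst (λ y → T (χ (element s) p ∨ χ y p)) (sym (¬ᴾ-special s)) (partner-covers s p)
  ... | ordinary o =
    subst (λ b → T (χ x p ∨ b)) (sym (trans (cong (λ y → χ y p) (¬ᴾ-ordinary o)) (χ-∁ x p)))
          (tautology (λ a _ _ → a ∨ not a) (χ x p) false false)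

  partnerNegation : Negation 𝒜
  partnerNegation = record
    { ¬ᴬ            = ¬ᴾ
    ; ¬ᴬ-involutive = ¬ᴾ-involutive
    ; ¬ᴬ-covers     = ¬ᴾ-covers
    }

-- A nonempty finite set is stored as its characteristic bits strictly below its maximum, so
-- every finite subset of ℕ has exactly one representation.
data FinSet : Set where
  ∅    : FinSet
  bits : List Bool → FinSet

χᴸ : List Bool → ℕ → Bool
χᴸ []       _       = false
χᴸ (b ∷ _)  zero    = b
χᴸ (_ ∷ bs) (suc n) = χᴸ bs n

toBits : FinSet → List Bool
toBits ∅         = []
toBits (bits bs) = bs ∷ʳ true

χᶠ : FinSet → ℕ → Bool
χᶠ s = χᴸ (toBits s)

infixr 5 _◃_
_◃_ : Bool → FinSet → FinSet
b     ◃ bits bs = bits (b ∷ bs)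
false ◃ ∅       = ∅
true  ◃ ∅       = bits []

χᶠ-◃ : ∀ b s n → χᶠ (b ◃ s) n ≡ χᴸ (b ∷ toBits s) n
χᶠ-◃ false ∅         zero    = refl
χᶠ-◃ false ∅         (suc n) = refl
χᶠ-◃ true  ∅         zero    = refl
χᶠ-◃ true  ∅         (suc n) = refl
χᶠ-◃ b     (bits bs) n       = refl

fromBits : List Bool → FinSet
fromBits = foldr _◃_ ∅

χᶠ-fromBits : ∀ bs n → χᶠ (fromBits bs) n ≡ χᴸ bs n
χᶠ-fromBits []       n       = refl
χᶠ-fromBits (b ∷ bs) zero    = χᶠ-◃ b (fromBits bs) zero
χᶠ-fromBits (b ∷ bs) (suc n) = trans (χᶠ-◃ b (fromBits bs) (suc n)) (χᶠ-fromBits bs n)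

-- Unlike Data.List.zipWith, this pads the shorter list with false.
zipWithᴸ : (Bool → Bool → Bool) → List Bool → List Bool → List Bool
zipWithᴸ f []       []       = []
zipWithᴸ f []       (c ∷ cs) = f false c ∷ zipWithᴸ f [] cs
zipWithᴸ f (b ∷ bs) []       = f b false ∷ zipWithᴸ f bs []
zipWithᴸ f (b ∷ bs) (c ∷ cs) = f b c ∷ zipWithᴸ f bs cs

χᴸ-zipWith : ∀ f → f false false ≡ false →
             ∀ bs cs n → χᴸ (zipWithᴸ f bs cs) n ≡ f (χᴸ bs n) (χᴸ cs n)
χᴸ-zipWith f f-ff []       []       n       = sym f-ff
χᴸ-zipWith f f-ff []       (c ∷ cs) zero    = refl
χᴸ-zipWith f f-ff []       (c ∷ cs) (suc n) = χᴸ-zipWith f f-ff [] cs n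
χᴸ-zipWith f f-ff (b ∷ bs) []       zero    = refl
χᴸ-zipWith f f-ff (b ∷ bs) []       (suc n) = χᴸ-zipWith f f-ff bs [] n
χᴸ-zipWith f f-ff (b ∷ bs) (c ∷ cs) zero    = refl
χᴸ-zipWith f f-ff (b ∷ bs) (c ∷ cs) (suc n) = χᴸ-zipWith f f-ff bs cs n

zipWithᶠ : (Bool → Bool → Bool) → FinSet → FinSet → FinSet
zipWithᶠ f s t = fromBits (zipWithᴸ f (toBits s) (toBits t))

χᶠ-zipWith : ∀ f → f false false ≡ false →
             ∀ s t n → χᶠ (zipWithᶠ f s t) n ≡ f (χᶠ s n) (χᶠ t n)
χᶠ-zipWith f f-ff s t n =
  trans (χᶠ-fromBits (zipWithᴸ f (toBits s) (toBits t)) n)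
        (χᴸ-zipWith f f-ff (toBits s) (toBits t) n)

bound : FinSet → ℕ
bound ∅         = 0
bound (bits bs) = suc (length bs)

χᶠ-max : ∀ bs → χᶠ (bits bs) (length bs) ≡ true
χᶠ-max []       = refl
χᶠ-max (_ ∷ bs) = χᶠ-max bs

χᶠ-beyond : ∀ s {n} → bound s ≤ n → χᶠ s n ≡ false
χᶠ-beyond ∅               _         = refl
χᶠ-beyond (bits [])       (s≤s _)   = refl
χᶠ-beyond (bits (_ ∷ bs)) (s≤s b≤n) = χᶠ-beyond (bits bs) b≤n

χᶠ-injective : ∀ {s t} → χᶠ s ≗ χᶠ t → s ≡ t
χᶠ-injective {∅}       {∅}       _  = refl
χᶠ-injective {∅}       {bits cs} eq =
  contradiction (trans (eq (length cs)) (χᶠ-max cs)) λ ()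
χᶠ-injective {bits bs} {∅}       eq =
  contradiction (trans (sym (eq (length bs))) (χᶠ-max bs)) λ ()
χᶠ-injective {bits []} {bits []} _  = refl
χᶠ-injective {bits []} {bits (_ ∷ cs)} eq =
  contradiction (χᶠ-injective {∅} {bits cs} (eq ∘ suc)) λ ()
χᶠ-injective {bits (_ ∷ bs)} {bits []} eq =
  contradiction (χᶠ-injective {bits bs} {∅} (eq ∘ suc)) λ ()
χᶠ-injective {bits (b ∷ bs)} {bits (c ∷ cs)} eq
  with refl ← eq 0 | refl ← χᶠ-injective {bits bs} {bits cs} (eq ∘ suc) = refl

_≟ᶠ_ : DecidableEquality FinSet
∅       ≟ᶠ ∅       = yes refl
∅       ≟ᶠ bits _  = no λ ()
bits _  ≟ᶠ ∅       = no λ ()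
bits bs ≟ᶠ bits cs = Dec.map′ (cong bits) (λ { refl → refl }) (≡-decᴸ _≟ᵇ_ bs cs)

-- (false , s) denotes s and (true , s) denotes ℕ ∖ s.
FinCofin : Set
FinCofin = Bool × FinSet

finite cofinite : FinSet → FinCofin
finite   s = false , s
cofinite s = true , s

χᶠᶜ : FinCofin → ℕ → Bool
χᶠᶜ (b , s) n = b xor χᶠ s n

-- On the stored finite parts, f acts through the conjugate g x y = f b c xor f (b xor x) (c xor y),
-- which satisfies g false false ≡ false as zipWithᶠ requires.
zipWithᶠᶜ : (Bool → Bool → Bool) → FinCofin → FinCofin → FinCofin
zipWithᶠᶜ f (b , s) (c , t) = f b c , zipWithᶠ (λ x y → f b c xor f (b xor x) (c xor y)) s t

χᶠᶜ-zipWith : ∀ f x y n → χᶠᶜ (zipWithᶠᶜ f x y) n ≡ f (χᶠᶜ x n) (χᶠᶜ y n)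
χᶠᶜ-zipWith f (b , s) (c , t) n =
  trans (cong (f b c xor_) (χᶠ-zipWith _ conjugate-ff s t n)) (xor-cancelˡ (f b c) _)
  where
    conjugate-ff : f b c xor f (b xor false) (c xor false) ≡ false
    conjugate-ff = trans (cong₂ (λ x y → f b c xor f x y) (xor-identityʳ b) (xor-identityʳ c))
                         (xor-same (f b c))

-- Two elements with different flags differ beyond both stored finite parts.
χᶠᶜ-injective : ∀ {x y} → χᶠᶜ x ≗ χᶠᶜ y → x ≡ y
χᶠᶜ-injective {b , s} {c , t} eq = cong₂ _,_ flags-equal (χᶠ-injective parts-equal)
  where
    open ≡-Reasoning

    far : ℕ
    far = bound s + bound t

    flags-equal : b ≡ c
    flags-equal = begin
      b                 ≡⟨ sym (xor-identityʳ b) ⟩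
      b xor false       ≡⟨ cong (b xor_) (sym (χᶠ-beyond s (m≤m+n (bound s) (bound t)))) ⟩
      χᶠᶜ (b , s) far   ≡⟨ eq far ⟩
      χᶠᶜ (c , t) far   ≡⟨ cong (c xor_) (χᶠ-beyond t (m≤n+m (bound t) (bound s))) ⟩
      c xor false       ≡⟨ xor-identityʳ c ⟩
      c                 ∎

    parts-equal : χᶠ s ≗ χᶠ t
    parts-equal n = begin
      χᶠ s n                ≡⟨ sym (xor-cancelˡ b (χᶠ s n)) ⟩
      b xor (b xor χᶠ s n)  ≡⟨ cong (b xor_) (eq n) ⟩
      b xor (c xor χᶠ t n)  ≡⟨ cong (λ a → a xor (c xor χᶠ t n)) flags-equal ⟩
      c xor (c xor χᶠ t n)  ≡⟨ xor-cancelˡ c (χᶠ t n) ⟩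
      χᶠ t n                ∎

finCofin : SetAlgebra ℕ
finCofin = record
  { Carrier     = FinCofin
  ; χ           = χᶠᶜ
  ; χ-injective = χᶠᶜ-injective
  ; zipWith     = zipWithᶠᶜ
  ; χ-zipWith   = χᶠᶜ-zipWith
  }

open SetAlgebra finCofin using () renaming (_⊆_ to _⊆ᶠᶜ_)

_≟ᶠᶜ_ : DecidableEquality FinCofin
_≟ᶠᶜ_ = ≡-dec× _≟ᵇ_ _≟ᶠ_

segment : ℕ → FinSet
segment zero    = ∅
segment (suc k) = bits (replicate k true)

bound-segment : ∀ k → bound (segment k) ≡ k
bound-segment zero    = refl
bound-segment (suc k) = cong suc (length-replicate k)

segment-mono : ∀ k → finite (segment k) ⊆ᶠᶜ finite (segment (suc k))
segment-mono zero          _       = tt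
segment-mono (suc zero)    zero    = tt
segment-mono (suc zero)    (suc _) = tt
segment-mono (suc (suc k)) zero    = tt
segment-mono (suc (suc k)) (suc n) = segment-mono (suc k) n

cofinite-antitone : ∀ {s t} → finite s ⊆ᶠᶜ finite t → cofinite t ⊆ᶠᶜ cofinite s
cofinite-antitone {s} {t} s⊆t n = ⇒ᵇ-contrapose {χᶠ s n} {χᶠ t n} (s⊆t n)

segment⁺ : ℤ → FinSet
segment⁺ (+ k)      = segment k
segment⁺ -[1+ _ ]   = ∅

bound-segment⁺ : ∀ z → bound (segment⁺ z) ⊖ bound (segment⁺ (- z)) ≡ z
bound-segment⁺ (+ zero)  = refl
bound-segment⁺ (+ suc k) = cong (_⊖ 0) (bound-segment (suc k))
bound-segment⁺ -[1+ t ]  = cong (0 ⊖_) (bound-segment (suc t))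

-- Three increasing ℤ-indexed chains: below z = {n | n < z}, above z = {n | -z ≤ n},
-- and step z, which is ℕ or ∅ according as 0 ≤ z or not.
below above step : ℤ → FinCofin
below z = finite (segment⁺ z)
above z = cofinite (segment⁺ (- z))
step (+ _)    = cofinite ∅
step -[1+ _ ] = finite ∅

below-mono : ∀ z → below z ⊆ᶠᶜ below (sucℤ z)
below-mono (+ k)          = segment-mono k
below-mono -[1+ zero ]  _ = tt
below-mono -[1+ suc _ ] _ = tt

above-mono : ∀ z → above z ⊆ᶠᶜ above (sucℤ z)
above-mono (+ _)          _ = ⇒ᵇ-true _
above-mono -[1+ zero ]    _ = ⇒ᵇ-true _
above-mono -[1+ suc t ]     =
  cofinite-antitone {segment (suc t)} {segment (suc (suc t))} (segment-mono (suc t))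

step-mono : ∀ z → step z ⊆ᶠᶜ step (sucℤ z)
step-mono (+ _)          _ = tt
step-mono -[1+ zero ]    _ = tt
step-mono -[1+ suc _ ]   _ = tt

Triple : Set
Triple = FinCofin × FinCofin × FinCofin

triples : SetAlgebra (ℕ ⊎ ℕ ⊎ ℕ)
triples = finCofin ×ˢ finCofin ×ˢ finCofin

open SetAlgebra triples using (χ; ∁; ∁-involutive; _⊆_; ⊆⇒∁-covers)

_≟_ : DecidableEquality Triple
_≟_ = ≡-dec× _≟ᶠᶜ_ (≡-dec× _≟ᶠᶜ_ _≟ᶠᶜ_)

data Family : Set where
  X Z : Family

-- Arranged so that X 0 ∩ ∁ (X (-1)), i.e. X 0 ∩ ¬ (X 0), is Z 0.
chain : Family → ℤ → Triple
chain X z = step z  , above z         , below z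
chain Z z = above z , below (sucℤ z)  , below z

chain-mono : ∀ f z → chain f z ⊆ chain f (sucℤ z)
chain-mono X z (inj₁ n)        = step-mono z n
chain-mono X z (inj₂ (inj₁ n)) = above-mono z n
chain-mono X z (inj₂ (inj₂ n)) = below-mono z n
chain-mono Z z (inj₁ n)        = above-mono z n
chain-mono Z z (inj₂ (inj₁ n)) = below-mono (sucℤ z) n
chain-mono Z z (inj₂ (inj₂ n)) = below-mono z n

index : Triple → Family × ℤ
index (_       , (true , r)  , (_ , u)) = X , bound u ⊖ bound r
index ((_ , r) , (false , _) , (_ , u)) = Z , bound u ⊖ bound r

index-chain : ∀ f z → index (chain f z) ≡ (f , z)
index-chain X z = cong (X ,_) (bound-segment⁺ z)
index-chain Z z = cong (Z ,_) (bound-segment⁺ z)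

index-∁∁-chain : ∀ f z → index (∁ (∁ (chain f z))) ≡ (f , z)
index-∁∁-chain f z = trans (cong index (∁-involutive (chain f z))) (index-chain f z)

data Special : Set where
  in-chain in-cochain : Family → ℤ → Special

element : Special → Triple
element (in-chain   f z) = chain f z
element (in-cochain f z) = ∁ (chain f z)

-- Chain elements have a finite third component, their complements a cofinite one.
candidate : Triple → Special
candidate x@(_ , _ , (false , _)) = uncurry in-chain (index x)
candidate x@(_ , _ , (true  , _)) = uncurry in-cochain (index (∁ x))

candidate-element : ∀ s → candidate (element s) ≡ s
candidate-element (in-chain   X z) = cong (uncurry in-chain) (index-chain X z)
candidate-element (in-chain   Z z) = cong (uncurry in-chain) (index-chain Z z)
candidate-element (in-cochain X z) = cong (uncurry in-cochain) (index-∁∁-chain X z)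
candidate-element (in-cochain Z z) = cong (uncurry in-cochain) (index-∁∁-chain Z z)

partner : Special → Special
partner (in-chain   f z) = in-cochain f (pred z)
partner (in-cochain f z) = in-chain f (sucℤ z)

partner-involutive : ∀ s → partner (partner s) ≡ s
partner-involutive (in-chain   f z) = cong (in-chain f) (suc-pred z)
partner-involutive (in-cochain f z) = cong (in-cochain f) (pred-suc z)

partner-covers : ∀ s p → T (χ (element s) p ∨ χ (element (partner s)) p)
partner-covers (in-chain f z) p =
  subst T (∨-comm (χ (∁ (chain f (pred z))) p) (χ (chain f z) p))
        (⊆⇒∁-covers (subst (chain f (pred z) ⊆_) (cong (chain f) (suc-pred z))
                           (chain-mono f (pred z))) p)
partner-covers (in-cochain f z) = ⊆⇒∁-covers (chain-mono f z)

∁-element : ∀ s → ∃ λ t → element t ≡ ∁ (element s)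
∁-element (in-chain   f z) = in-cochain f z , refl
∁-element (in-cochain f z) = in-chain f z , sym (∁-involutive (chain f z))

chainPartners : PartnerStructure triples
chainPartners = record
  { _≟_                = _≟_
  ; Special            = Special
  ; element            = element
  ; candidate          = candidate
  ; candidate-element  = candidate-element
  ; partner            = partner
  ; partner-involutive = partner-involutive
  ; partner-covers     = partner-covers
  ; ∁-element          = ∁-element
  }

chainNegation : Negation triples
chainNegation = PartnerNegation.partnerNegation chainPartners

open Soundness chainNegation using (unprovable)

-- ∘∘ (X 0) fails exactly on Z 1 ∖ Z 0: at 1 in the second and at 0 in the third component.
corollary4p11 : (∃ λ α → ¬ ⊢RCbr (∘′ ∘′ α))
                × (∃ λ α → ¬ ⊢RCbr (∘′ α ⇒ ∘′ ∘′ α))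
                × (∃ λ α → ¬ ⊢RCbr ((α ∧′ ∘′ α) ⇒ ∘′ ∘′ α))
                × (∃ λ α → ¬ ⊢RCbr ((¬′ α ∧′ ∘′ α) ⇒ ∘′ ∘′ α))
corollary4p11 =
    (var 0 , unprovable v₀ (inj₂ (inj₂ 0)) refl)
  , (var 0 , unprovable v₀ (inj₂ (inj₂ 0)) refl)
  , (var 0 , unprovable v₀ (inj₂ (inj₁ 1)) refl)
  , (var 0 , unprovable v₀ (inj₂ (inj₂ 0)) refl)
  where
    v₀ : ℕ → Triple
    v₀ _ = chain X (+ 0)
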